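{- Let $n\ge 2$, $1\le k\le n-1$, and let $G$ be a connected simple graph of order $n$ with edge connectivity $k$ such that $G$ has a trivial $k$-edge cut and $G\not\cong K^k_{n-1,1}$. Then $G\prec K^k_{n-1,1}$.
   Context: For $S\subsetneq V(G)$ nonempty, the edge cut $\partial(S)$ is the set of edges with exactly one end in $S$; it is a $k$-edge cut if it has $k$ edges, and it is trivial if $|S|=1$ (i.e. it is the set of edges at a single vertex). $m(G,t)$ is the number of $t$-matchings of $G$, $m(G,0)=1$. For graphs $G_1,G_2$ of order $n$, $G_1\preceq G_2$ means $m(G_1,t)\le m(G_2,t)$ for all $t=0,\dots,\lfloor n/2\rfloor$; $G_1\prec G_2$ means $G_1\preceq G_2$ and strict inequality holds for some $t$. $K^k_{n-1,1}$ is the graph obtained from $K_1\cup K_{n-1}$ by adding $k$ edges between the vertex of $K_1$ and $k$ distinct vertices of $K_{n-1}$. -}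

module Defs where

open import Data.Bool using (Bool; true; false; _∧_; _∨_; not; _xor_; if_then_else_)
open import Data.Nat using (ℕ; zero; suc; _≤_; _<_; _≡ᵇ_; _<ᵇ_; _≤ᵇ_; ⌊_/2⌋)
open import Data.Fin using (Fin; toℕ; _≟_)
open import Data.List using (List; []; _∷_; length; filter; concatMap; map; allFin)
open import Data.List.Base using () renaming (all to allᵇ)
open import Data.Product using (Σ; ∃; ∃-syntax; _×_; _,_)
open import Relation.Binary.PropositionalEquality as Eq using (_≡_; refl; cong)
open import Data.Empty using (⊥-elim)
import Data.Fin as Fin
open import Relation.Nullary.Decidable using (⌊_⌋)
open import Relation.Nullary using (¬_; yes; no)
open import Data.Fin.Permutation using (Permutation′; _⟨$⟩ʳ_)

record Graph (n : ℕ) : Set where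
  field
    adj    : Fin n → Fin n → Bool
    sym    : ∀ i j → adj i j ≡ adj j i
    irrefl : ∀ i → adj i i ≡ false
open Graph public

data Reach {n : ℕ} (G : Graph n) : Fin n → Fin n → Set where
  here : ∀ {i} → Reach G i i
  step : ∀ {i j k} → adj G i j ≡ true → Reach G j k → Reach G i k

Connected : ∀ {n} → Graph n → Set
Connected {n} G = ∀ (i j : Fin n) → Reach G i j

-- Edge list: each edge {i,j} listed once as (i , j) with toℕ i < toℕ j.
Edge : ℕ → Set
Edge n = Fin n × Fin n

edges : ∀ {n} → Graph n → List (Edge n)
edges {n} G =
  concatMap (λ i → concatMap (λ j → if (toℕ i <ᵇ toℕ j) ∧ adj G i j then (i , j) ∷ [] else []) (allFin n)) (allFin n)

VSet : ℕ → Set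
VSet n = Fin n → Bool

cut : ∀ {n} → Graph n → VSet n → List (Edge n)
cut G S = filter (λ e → Data.Bool.T? (S (Data.Product.proj₁ e) xor S (Data.Product.proj₂ e))) (edges G)
  where import Data.Bool ; import Data.Product

cutSize : ∀ {n} → Graph n → VSet n → ℕ
cutSize G S = length (cut G S)

NonemptyProper : ∀ {n} → VSet n → Set
NonemptyProper S = (∃[ v ] S v ≡ true) × (∃[ u ] S u ≡ false)

EdgeConnectivity : ∀ {n} → Graph n → ℕ → Set
EdgeConnectivity {n} G k =
  (∀ (S : VSet n) → NonemptyProper S → k ≤ cutSize G S)
  × (∃[ S ] (NonemptyProper S × cutSize G S ≡ k))

single : ∀ {n} → Fin n → VSet n
single v u = ⌊ u ≟ v ⌋

HasTrivialCut : ∀ {n} → Graph n → ℕ → Set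
HasTrivialCut G k = ∃[ v ] cutSize G (single v) ≡ k

choose : ∀ {A : Set} → ℕ → List A → List (List A)
choose zero    _        = [] ∷ []
choose (suc t) []       = []
choose (suc t) (x ∷ xs) = map (x ∷_) (choose t xs) Data.List.++ choose (suc t) xs
  where import Data.List

disjointᵇ : ∀ {n} → Edge n → Edge n → Bool
disjointᵇ (a , b) (c , d) =
  not (⌊ a ≟ c ⌋ ∨ ⌊ a ≟ d ⌋ ∨ ⌊ b ≟ c ⌋ ∨ ⌊ b ≟ d ⌋)

isMatchingᵇ : ∀ {n} → List (Edge n) → Bool
isMatchingᵇ []       = true
isMatchingᵇ (e ∷ es) = allᵇ (disjointᵇ e) es ∧ isMatchingᵇ es

matchings : ∀ {n} → Graph n → ℕ → ℕ
matchings G t = length (filter (λ M → Data.Bool.T? (isMatchingᵇ M)) (choose t (edges G)))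
  where import Data.Bool

_⪯_ : ∀ {n} → Graph n → Graph n → Set
_⪯_ {n} G₁ G₂ = ∀ t → t ≤ ⌊ n /2⌋ → matchings G₁ t ≤ matchings G₂ t

_≺_ : ∀ {n} → Graph n → Graph n → Set
_≺_ {n} G₁ G₂ = (G₁ ⪯ G₂) × (∃[ t ] (t ≤ ⌊ n /2⌋ × matchings G₁ t < matchings G₂ t))

Iso : ∀ {n} → Graph n → Graph n → Set
Iso {n} G H = Σ (Permutation′ n) (λ π → ∀ (i j : Fin n) → adj G i j ≡ adj H (π ⟨$⟩ʳ i) (π ⟨$⟩ʳ j))

-- K^k_{n-1,1}: vertex 0 is the K₁ vertex; vertices 1..n-1 form K_{n-1};
-- vertex 0 is joined to the k vertices 1..k.
Kadj : ∀ {n} → ℕ → Fin n → Fin n → Bool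
Kadj k Fin.zero    Fin.zero    = false
Kadj k Fin.zero    (Fin.suc b) = toℕ b <ᵇ k
Kadj k (Fin.suc a) Fin.zero    = toℕ a <ᵇ k
Kadj k (Fin.suc a) (Fin.suc b) = not ⌊ a ≟ b ⌋

private
  ≟-sym : ∀ {n} (a b : Fin n) → ⌊ a ≟ b ⌋ ≡ ⌊ b ≟ a ⌋
  ≟-sym a b with a ≟ b | b ≟ a
  ... | yes _ | yes _ = refl
  ... | no  _ | no  _ = refl
  ... | yes p | no ¬q = ⊥-elim (¬q (Eq.sym p))
  ... | no ¬p | yes q = ⊥-elim (¬p (Eq.sym q))

  ≟-refl : ∀ {n} (a : Fin n) → ⌊ a ≟ a ⌋ ≡ true
  ≟-refl a with a ≟ a
  ... | yes _ = refl
  ... | no ¬p = ⊥-elim (¬p refl)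

  Kadj-sym : ∀ {n} k (i j : Fin n) → Kadj k i j ≡ Kadj k j i
  Kadj-sym k Fin.zero    Fin.zero    = refl
  Kadj-sym k Fin.zero    (Fin.suc b) = refl
  Kadj-sym k (Fin.suc a) Fin.zero    = refl
  Kadj-sym k (Fin.suc a) (Fin.suc b) = cong not (≟-sym a b)

  Kadj-irrefl : ∀ {n} k (i : Fin n) → Kadj k i i ≡ false
  Kadj-irrefl k Fin.zero    = refl
  Kadj-irrefl k (Fin.suc a) = cong not (≟-refl a)

K : (n k : ℕ) → Graph n
K n k = record { adj = Kadj k ; sym = Kadj-sym k ; irrefl = Kadj-irrefl k }

-- Idea. v has at most k neighbours, so some vertex permutation π sends v to the K₁-vertex 0
-- of K^k_{n-1,1} and every neighbour of v into {1, …, k}; all other vertices land in the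
-- clique K_{n-1}.  Hence π maps every edge of G to an edge of K^k_{n-1,1}: G is isomorphic
-- to a spanning subgraph G′ of K^k_{n-1,1}.  Adding edges never decreases m(·,t), and since
-- G′ ≠ K^k_{n-1,1} (as G ≇ K^k_{n-1,1}) the subgraph has strictly fewer edges, i.e. a
-- strictly smaller m(·,1).
module Submission where

open import Algebra.Bundles using (CommutativeMonoid)
import Algebra.Properties.CommutativeSemigroup as CommutativeSemigroupLaws
open import Data.Bool using (Bool; true; false; _∧_; _∨_; not; T; T?; _xor_; if_then_else_)
import Data.Bool.Properties as Bool
open import Data.Bool.Properties using (∨-assoc; ∨-comm; ∨-commutativeMonoid; ∧-commutativeMonoid; T-≡; T-∧)
open import Data.Fin using (Fin; zero; suc; toℕ; _≟_; fromℕ; punchIn; punchOut)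
open import Data.Fin.Properties using (<-cmp; all?; ¬∀⟶∃¬; punchIn-injective; punchInᵢ≢i; punchIn-punchOut)
open import Data.Fin.Permutation using (Permutation′; _⟨$⟩ʳ_; _⟨$⟩ˡ_; inverseˡ; inverseʳ; insert; insert-punchIn)
import Data.Fin.Permutation as Permutation
open import Data.List using (List; []; _∷_; _++_; map; filter; length; concatMap; cartesianProduct; allFin; tabulate)
open import Data.List.Base using () renaming (all to allᵇ)
open import Data.List.Properties using (filter-++; length-++; length-map; map-++; map-∘; map-tabulate)
open import Data.List.Membership.Propositional using (_∈_; _∉_)
open import Data.List.Membership.Propositional.Properties
  using (∈-filter⁺; ∈-filter⁻; ∈-map⁻; ∈-cartesianProduct⁺; ∈-allFin)
open import Data.List.Membership.Propositional.Properties.WithK using (unique∧set⇒bag)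
open import Data.List.Relation.Binary.BagAndSetEquality using (∼bag⇒↭)
open import Data.List.Relation.Binary.Permutation.Propositional using (_↭_; refl; prep; swap; trans)
open import Data.List.Relation.Binary.Permutation.Propositional.Properties using (↭-length)
open import Data.List.Relation.Binary.Sublist.Propositional using (_⊆_; []; _∷_; _∷ʳ_; ⊆-refl)
open import Data.List.Relation.Binary.Sublist.Propositional.Properties using (length-mono-≤; filter-⊆; filter⁺)
open import Data.List.Relation.Unary.Any using (here; there)
import Data.List.Relation.Unary.All as All
import Data.List.Relation.Unary.All.Properties as All
open import Data.List.Relation.Unary.AllPairs using ([]; _∷_)
open import Data.List.Relation.Unary.Unique.Propositional using (Unique)
import Data.List.Relation.Unary.Unique.Propositional.Properties as Unique
open import Data.Nat using (ℕ; zero; suc; _+_; _≤_; _<_; _∸_; _<ᵇ_; ⌊_/2⌋; s≤s; z≤n)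
open import Data.Nat.Properties
  using (≤-refl; ≤-trans; ≤-reflexive; ≤-antisym; <-asym; +-mono-≤; m≤n+m; <⇒<ᵇ; <ᵇ⇒<; ⌊n/2⌋-mono;
         +-commutativeSemigroup; module ≤-Reasoning)
open import Data.Product using (Σ-syntax; ∃-syntax; ∃₂; _×_; _,_; proj₁; proj₂) renaming (swap to ×-swap)
open import Data.Product.Properties using (,-injective; ≡-dec)
open import Data.Sum using (_⊎_; inj₁; inj₂)
open import Function using (_∘_; id)
open import Function.Bundles using (Equivalence; mk⇔)
open import Function.Definitions using (Injective)
open import Relation.Binary.Definitions using (DecidableEquality; tri<; tri≈; tri>)
open import Relation.Binary.PropositionalEquality
  using (_≡_; _≢_; refl; cong; cong₂; sym; subst; subst₂; module ≡-Reasoning)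
  renaming (trans to ≡-trans)
open import Relation.Nullary using (¬_; yes; no; contradiction)
open import Relation.Nullary.Decidable using (⌊_⌋)
open import Defs hiding (sym)

open Equivalence using (to; from)

module +-laws = CommutativeSemigroupLaws +-commutativeSemigroup
module ∨-laws = CommutativeSemigroupLaws (CommutativeMonoid.commutativeSemigroup ∨-commutativeMonoid)
module ∧-laws = CommutativeSemigroupLaws (CommutativeMonoid.commutativeSemigroup ∧-commutativeMonoid)

private
  variable
    A B : Set
    m n : ℕ

#[_] : (A → Bool) → List A → ℕ
#[ p ] xs = length (filter (λ x → T? (p x)) xs)

#-∷-true : ∀ (p : A → Bool) {x} xs → p x ≡ true → #[ p ] (x ∷ xs) ≡ suc (#[ p ] xs)
#-∷-true p {x} xs px with p x
... | true = refl

#-∷-false : ∀ (p : A → Bool) {x} xs → p x ≡ false → #[ p ] (x ∷ xs) ≡ #[ p ] xs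
#-∷-false p {x} xs px with p x
... | false = refl

#-++ : ∀ (p : A → Bool) xs ys → #[ p ] (xs ++ ys) ≡ #[ p ] xs + #[ p ] ys
#-++ p xs ys = ≡-trans (cong length (filter-++ (λ x → T? (p x)) xs ys)) (length-++ (filter (λ x → T? (p x)) xs))

#-map : ∀ (p : A → Bool) (f : B → A) xs → #[ p ] (map f xs) ≡ #[ (λ y → p (f y)) ] xs
#-map p f []       = refl
#-map p f (x ∷ xs) with p (f x)
... | true  = cong suc (#-map p f xs)
... | false = #-map p f xs

#-cong : ∀ {p q : A → Bool} → (∀ x → p x ≡ q x) → ∀ xs → #[ p ] xs ≡ #[ q ] xs
#-cong p≗q [] = refl
#-cong {p = p} {q = q} p≗q (x ∷ xs) with p x | q x | p≗q x
... | true  | true  | refl = cong suc (#-cong p≗q xs)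
... | false | false | refl = #-cong p≗q xs

#-choose-∷ : ∀ (P : List A → Bool) t (x : A) xs →
  #[ P ] (choose (suc t) (x ∷ xs)) ≡ #[ (λ M → P (x ∷ M)) ] (choose t xs) + #[ P ] (choose (suc t) xs)
#-choose-∷ P t x xs =
  ≡-trans (#-++ P (map (x ∷_) (choose t xs)) _) (cong (_+ _) (#-map P (x ∷_) (choose t xs)))

-- A sublist has at most as many good t-sublists; this is why adding edges cannot
-- decrease a matching number.
#-choose-⊆ : ∀ (P : List A → Bool) t {xs ys} → xs ⊆ ys →
  #[ P ] (choose t xs) ≤ #[ P ] (choose t ys)
#-choose-⊆ P zero    _  = ≤-refl
#-choose-⊆ P (suc t) [] = ≤-refl
#-choose-⊆ P (suc t) {xs} {y ∷ ys} (y ∷ʳ s) = begin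
  #[ P ] (choose (suc t) xs)                                         ≤⟨ #-choose-⊆ P (suc t) s ⟩
  #[ P ] (choose (suc t) ys)                                         ≤⟨ m≤n+m _ _ ⟩
  #[ (λ M → P (y ∷ M)) ] (choose t ys) + #[ P ] (choose (suc t) ys)  ≡⟨ sym (#-choose-∷ P t y ys) ⟩
  #[ P ] (choose (suc t) (y ∷ ys))                                   ∎
  where open ≤-Reasoning
#-choose-⊆ P (suc t) {x ∷ xs} {x ∷ ys} (refl ∷ s) = begin
  #[ P ] (choose (suc t) (x ∷ xs))
    ≡⟨ #-choose-∷ P t x xs ⟩
  #[ (λ M → P (x ∷ M)) ] (choose t xs) + #[ P ] (choose (suc t) xs)
    ≤⟨ +-mono-≤ (#-choose-⊆ (λ M → P (x ∷ M)) t s) (#-choose-⊆ P (suc t) s) ⟩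
  #[ (λ M → P (x ∷ M)) ] (choose t ys) + #[ P ] (choose (suc t) ys)
    ≡⟨ sym (#-choose-∷ P t x ys) ⟩
  #[ P ] (choose (suc t) (x ∷ ys))
    ∎
  where open ≤-Reasoning

PermInvariant : (List A → Bool) → Set
PermInvariant {A} P = ∀ {M M′ : List A} → M ↭ M′ → P M ≡ P M′

-- xs and ys have equally many t-sublists passing every order-independent test; this is
-- the invariant proved by induction on a permutation xs ↭ ys.
SameCounts : List A → List A → Set
SameCounts {A} xs ys =
  ∀ (P : List A → Bool) → PermInvariant P → ∀ t → #[ P ] (choose t xs) ≡ #[ P ] (choose t ys)

sameCounts-prep : ∀ (x : A) {xs ys} → SameCounts xs ys → SameCounts (x ∷ xs) (x ∷ ys)
sameCounts-prep x         same P P-inv zero    = refl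
sameCounts-prep x {xs} {ys} same P P-inv (suc t) = begin
  #[ P ] (choose (suc t) (x ∷ xs))                                   ≡⟨ #-choose-∷ P t x xs ⟩
  #[ (λ M → P (x ∷ M)) ] (choose t xs) + #[ P ] (choose (suc t) xs)
    ≡⟨ cong₂ _+_ (same _ (λ p → P-inv (prep x p)) t) (same P P-inv (suc t)) ⟩
  #[ (λ M → P (x ∷ M)) ] (choose t ys) + #[ P ] (choose (suc t) ys)  ≡⟨ sym (#-choose-∷ P t x ys) ⟩
  #[ P ] (choose (suc t) (x ∷ ys))                                   ∎
  where open ≡-Reasoning

-- Exchanging the first two entries: expanding by Pascal's rule twice, the four parts are
-- the same up to order, the part containing both x and y by order-independence of P.
sameCounts-swap : ∀ (x y : A) xs → SameCounts (x ∷ y ∷ xs) (y ∷ x ∷ xs)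
sameCounts-swap x y xs P P-inv zero = refl
sameCounts-swap x y xs P P-inv (suc zero) = begin
  #[ P ] (choose 1 (x ∷ y ∷ xs))      ≡⟨ expand x y ⟩
  Px + (Py + #[ P ] (choose 1 xs))    ≡⟨ +-laws.x∙yz≈y∙xz Px Py _ ⟩
  Py + (Px + #[ P ] (choose 1 xs))    ≡⟨ sym (expand y x) ⟩
  #[ P ] (choose 1 (y ∷ x ∷ xs))      ∎
  where
  open ≡-Reasoning
  Px Py : ℕ
  Px = #[ (λ M → P (x ∷ M)) ] (choose 0 xs)
  Py = #[ (λ M → P (y ∷ M)) ] (choose 0 xs)
  expand : ∀ a b → #[ P ] (choose 1 (a ∷ b ∷ xs)) ≡
    #[ (λ M → P (a ∷ M)) ] (choose 0 xs) + (#[ (λ M → P (b ∷ M)) ] (choose 0 xs) + #[ P ] (choose 1 xs))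
  expand a b = ≡-trans (#-choose-∷ P 0 a (b ∷ xs)) (cong (_ +_) (#-choose-∷ P 0 b xs))
sameCounts-swap x y xs P P-inv (suc (suc t)) = begin
  #[ P ] (choose (2 + t) (x ∷ y ∷ xs))  ≡⟨ expand x y ⟩
  (Pxy + Px) + (Py + Rest)
    ≡⟨ cong (λ c → (c + Px) + (Py + Rest)) (#-cong (λ M → P-inv (swap x y refl)) (choose t xs)) ⟩
  (Pyx + Px) + (Py + Rest)              ≡⟨ +-laws.interchange Pyx Px Py Rest ⟩
  (Pyx + Py) + (Px + Rest)              ≡⟨ sym (expand y x) ⟩
  #[ P ] (choose (2 + t) (y ∷ x ∷ xs))  ∎
  where
  open ≡-Reasoning
  Pxy Pyx Px Py Rest : ℕ
  Pxy  = #[ (λ M → P (x ∷ y ∷ M)) ] (choose t xs)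
  Pyx  = #[ (λ M → P (y ∷ x ∷ M)) ] (choose t xs)
  Px   = #[ (λ M → P (x ∷ M)) ] (choose (suc t) xs)
  Py   = #[ (λ M → P (y ∷ M)) ] (choose (suc t) xs)
  Rest = #[ P ] (choose (2 + t) xs)
  expand : ∀ a b → #[ P ] (choose (2 + t) (a ∷ b ∷ xs)) ≡
    (#[ (λ M → P (a ∷ b ∷ M)) ] (choose t xs) + #[ (λ M → P (a ∷ M)) ] (choose (suc t) xs))
    + (#[ (λ M → P (b ∷ M)) ] (choose (suc t) xs) + Rest)
  expand a b = ≡-trans (#-choose-∷ P (suc t) a (b ∷ xs))
    (cong₂ _+_ (#-choose-∷ (λ M → P (a ∷ M)) t b xs) (#-choose-∷ P (suc t) b xs))

sameCounts-↭ : ∀ {xs ys : List A} → xs ↭ ys → SameCounts xs ys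
sameCounts-↭ refl        P P-inv t = refl
sameCounts-↭ (trans p q) P P-inv t = ≡-trans (sameCounts-↭ p P P-inv t) (sameCounts-↭ q P P-inv t)
sameCounts-↭ (prep x p)            = sameCounts-prep x (sameCounts-↭ p)
sameCounts-↭ (swap {xs} {ys} x y p) P P-inv t =
  ≡-trans (sameCounts-prep x (sameCounts-prep y (sameCounts-↭ p)) P P-inv t) (sameCounts-swap x y ys P P-inv t)

choose-map : ∀ (f : A → B) t xs → choose t (map f xs) ≡ map (map f) (choose t xs)
choose-map f zero    xs       = refl
choose-map f (suc t) []       = refl
choose-map f (suc t) (x ∷ xs) = begin
  map (f x ∷_) (choose t (map f xs)) ++ choose (suc t) (map f xs)
    ≡⟨ cong₂ _++_ (cong (map (f x ∷_)) (choose-map f t xs)) (choose-map f (suc t) xs) ⟩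
  map (f x ∷_) (map (map f) (choose t xs)) ++ map (map f) (choose (suc t) xs)
    ≡⟨ cong (_++ _) (≡-trans (sym (map-∘ (choose t xs))) (map-∘ (choose t xs))) ⟩
  map (map f) (map (x ∷_) (choose t xs)) ++ map (map f) (choose (suc t) xs)
    ≡⟨ sym (map-++ (map f) (map (x ∷_) (choose t xs)) _) ⟩
  map (map f) (map (x ∷_) (choose t xs) ++ choose (suc t) xs)
    ∎
  where open ≡-Reasoning

#-choose-map : ∀ (P : List B → Bool) (f : A → B) t xs →
  #[ P ] (choose t (map f xs)) ≡ #[ (λ M → P (map f M)) ] (choose t xs)
#-choose-map P f t xs = ≡-trans (cong #[ P ] (choose-map f t xs)) (#-map P (map f) (choose t xs))

#-choose-1 : ∀ (P : List A → Bool) → (∀ x → P (x ∷ []) ≡ true) → ∀ xs → #[ P ] (choose 1 xs) ≡ length xs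
#-choose-1 P P-single []       = refl
#-choose-1 P P-single (x ∷ xs) with P (x ∷ []) | P-single x
... | true | refl = cong suc (#-choose-1 P P-single xs)

sublist-length-< : ∀ {xs ys : List A} {y} → xs ⊆ ys → y ∈ ys → y ∉ xs → length xs < length ys
sublist-length-< (_ ∷ʳ s)   _           _   = s≤s (length-mono-≤ s)
sublist-length-< (refl ∷ s) (here refl) y∉ = contradiction (here refl) y∉
sublist-length-< (refl ∷ s) (there y∈)  y∉ = s≤s (sublist-length-< s y∈ (y∉ ∘ there))

-- A duplicate-free list contained in a duplicate-free ys is a rearrangement of a sublist of ys
-- (namely of ys filtered by membership in xs).
unique-⊆⇒↭-sublist : DecidableEquality A → ∀ {xs ys : List A} → Unique xs → Unique ys →
  (∀ {x} → x ∈ xs → x ∈ ys) → ∃[ zs ] (xs ↭ zs × zs ⊆ ys)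
unique-⊆⇒↭-sublist _≟_ {xs} {ys} xs-unique ys-unique xs⊆ys =
  filter (_∈? xs) ys ,
  ∼bag⇒↭ (unique∧set⇒bag xs-unique (Unique.filter⁺ (_∈? xs) ys-unique)
    (mk⇔ (λ x∈xs → ∈-filter⁺ (_∈? xs) (xs⊆ys x∈xs) x∈xs)
         (λ x∈zs → proj₂ (∈-filter⁻ (_∈? xs) {xs = ys} x∈zs)))) ,
  filter-⊆ (_∈? xs) ys
  where open import Data.List.Membership.DecPropositional _≟_ using (_∈?_)

unique-length-≤ : DecidableEquality A → ∀ {xs ys : List A} → Unique xs → Unique ys →
  (∀ {x} → x ∈ xs → x ∈ ys) → length xs ≤ length ys
unique-length-≤ _≟_ xs-unique ys-unique xs⊆ys
  with (zs , xs↭zs , zs⊆ys) ← unique-⊆⇒↭-sublist _≟_ xs-unique ys-unique xs⊆ys =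
  ≤-trans (≤-reflexive (↭-length xs↭zs)) (length-mono-≤ zs⊆ys)

unique-map : ∀ (f : A → B) {xs} → (∀ {x y} → x ∈ xs → y ∈ xs → f x ≡ f y → x ≡ y) →
  Unique xs → Unique (map f xs)
unique-map f f-inj []                 = []
unique-map f f-inj (x∉xs ∷ xs-unique) =
  All.map⁺ (All.tabulate (λ y∈xs fx≡fy → All.lookup x∉xs y∈xs (f-inj (here refl) (there y∈xs) fx≡fy)))
  ∷ unique-map f (λ x∈ y∈ → f-inj (there x∈) (there y∈)) xs-unique

⌊≟⌋-sym : ∀ (a b : Fin n) → ⌊ a ≟ b ⌋ ≡ ⌊ b ≟ a ⌋
⌊≟⌋-sym a b with a ≟ b | b ≟ a
... | yes _   | yes _   = refl
... | no  _   | no  _   = refl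
... | yes a≡b | no  b≢a = contradiction (sym a≡b) b≢a
... | no  a≢b | yes b≡a = contradiction (sym b≡a) a≢b

⌊≟⌋-injective : ∀ {f : Fin n → Fin n} → Injective _≡_ _≡_ f → ∀ a b → ⌊ f a ≟ f b ⌋ ≡ ⌊ a ≟ b ⌋
⌊≟⌋-injective {f = f} f-inj a b with a ≟ b | f a ≟ f b
... | yes _   | yes _     = refl
... | no  _   | no  _     = refl
... | yes a≡b | no  fa≢fb = contradiction (cong f a≡b) fa≢fb
... | no  a≢b | yes fa≡fb = contradiction (f-inj fa≡fb) a≢b

-- The representative (min , max) of the unordered pair {a, b}, the form in which
-- `edges` lists an edge.
orient : Edge n → Edge n
orient (a , b) with <-cmp a b
... | tri< _ _ _ = (a , b)
... | tri≈ _ _ _ = (a , b)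
... | tri> _ _ _ = (b , a)

orient-cases : ∀ (a b : Fin n) → orient (a , b) ≡ (a , b) ⊎ orient (a , b) ≡ (b , a)
orient-cases a b with <-cmp a b
... | tri< _ _ _ = inj₁ refl
... | tri≈ _ _ _ = inj₁ refl
... | tri> _ _ _ = inj₂ refl

orient-ordered : ∀ {a b : Fin n} → a ≢ b → toℕ (proj₁ (orient (a , b))) < toℕ (proj₂ (orient (a , b)))
orient-ordered {a = a} {b} a≢b with <-cmp a b
... | tri< a<b _ _ = a<b
... | tri≈ _ a≡b _ = contradiction a≡b a≢b
... | tri> _ _ b<a = b<a

orient-≡ : ∀ {a b c d : Fin n} → orient (a , b) ≡ orient (c , d) → (a ≡ c × b ≡ d) ⊎ (a ≡ d × b ≡ c)
orient-≡ {a = a} {b} {c} {d} eq with orient-cases a b | orient-cases c d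
... | inj₁ ab | inj₁ cd = inj₁ (,-injective (≡-trans (sym ab) (≡-trans eq cd)))
... | inj₁ ab | inj₂ dc = inj₂ (,-injective (≡-trans (sym ab) (≡-trans eq dc)))
... | inj₂ ba | inj₁ cd = inj₂ (×-swap (,-injective (≡-trans (sym ba) (≡-trans eq cd))))
... | inj₂ ba | inj₂ dc = inj₁ (×-swap (,-injective (≡-trans (sym ba) (≡-trans eq dc))))

disjoint-sym : ∀ (e f : Edge n) → disjointᵇ e f ≡ disjointᵇ f e
disjoint-sym (a , b) (c , d) = cong not (begin
  ⌊ a ≟ c ⌋ ∨ ⌊ a ≟ d ⌋ ∨ ⌊ b ≟ c ⌋ ∨ ⌊ b ≟ d ⌋
    ≡⟨ cong (⌊ a ≟ c ⌋ ∨_) (∨-laws.x∙yz≈y∙xz ⌊ a ≟ d ⌋ ⌊ b ≟ c ⌋ _) ⟩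
  ⌊ a ≟ c ⌋ ∨ ⌊ b ≟ c ⌋ ∨ ⌊ a ≟ d ⌋ ∨ ⌊ b ≟ d ⌋
    ≡⟨ cong₂ _∨_ (⌊≟⌋-sym a c) (cong₂ _∨_ (⌊≟⌋-sym b c) (cong₂ _∨_ (⌊≟⌋-sym a d) (⌊≟⌋-sym b d))) ⟩
  ⌊ c ≟ a ⌋ ∨ ⌊ c ≟ b ⌋ ∨ ⌊ d ≟ a ⌋ ∨ ⌊ d ≟ b ⌋
    ∎)
  where open ≡-Reasoning

disjoint-flip : ∀ (a b : Fin n) f → disjointᵇ (b , a) f ≡ disjointᵇ (a , b) f
disjoint-flip a b (c , d) = cong not (begin
  ⌊ b ≟ c ⌋ ∨ ⌊ b ≟ d ⌋ ∨ (⌊ a ≟ c ⌋ ∨ ⌊ a ≟ d ⌋)  ≡⟨ sym (∨-assoc ⌊ b ≟ c ⌋ _ _) ⟩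
  (⌊ b ≟ c ⌋ ∨ ⌊ b ≟ d ⌋) ∨ ⌊ a ≟ c ⌋ ∨ ⌊ a ≟ d ⌋  ≡⟨ ∨-comm (⌊ b ≟ c ⌋ ∨ _) _ ⟩
  (⌊ a ≟ c ⌋ ∨ ⌊ a ≟ d ⌋) ∨ ⌊ b ≟ c ⌋ ∨ ⌊ b ≟ d ⌋  ≡⟨ ∨-assoc ⌊ a ≟ c ⌋ _ _ ⟩
  ⌊ a ≟ c ⌋ ∨ ⌊ a ≟ d ⌋ ∨ ⌊ b ≟ c ⌋ ∨ ⌊ b ≟ d ⌋    ∎)
  where open ≡-Reasoning

disjoint-orientˡ : ∀ (e f : Edge n) → disjointᵇ (orient e) f ≡ disjointᵇ e f
disjoint-orientˡ (a , b) f with orient-cases a b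
... | inj₁ ab = cong (λ e → disjointᵇ e f) ab
... | inj₂ ba = ≡-trans (cong (λ e → disjointᵇ e f) ba) (disjoint-flip a b f)

disjoint-orient : ∀ (e f : Edge n) → disjointᵇ (orient e) (orient f) ≡ disjointᵇ e f
disjoint-orient e f = begin
  disjointᵇ (orient e) (orient f)  ≡⟨ disjoint-orientˡ e (orient f) ⟩
  disjointᵇ e (orient f)           ≡⟨ disjoint-sym e (orient f) ⟩
  disjointᵇ (orient f) e           ≡⟨ disjoint-orientˡ f e ⟩
  disjointᵇ f e                    ≡⟨ disjoint-sym f e ⟩
  disjointᵇ e f                    ∎
  where open ≡-Reasoning

disjoint-injective : ∀ {g : Fin n → Fin n} → Injective _≡_ _≡_ g → ∀ a b c d →
  disjointᵇ (g a , g b) (g c , g d) ≡ disjointᵇ (a , b) (c , d)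
disjoint-injective g-inj a b c d
  rewrite ⌊≟⌋-injective g-inj a c | ⌊≟⌋-injective g-inj a d
        | ⌊≟⌋-injective g-inj b c | ⌊≟⌋-injective g-inj b d = refl

all-↭ : ∀ (p : A → Bool) {xs ys} → xs ↭ ys → allᵇ p xs ≡ allᵇ p ys
all-↭ p refl        = refl
all-↭ p (trans q r) = ≡-trans (all-↭ p q) (all-↭ p r)
all-↭ p (prep x q)  = cong (p x ∧_) (all-↭ p q)
all-↭ p (swap {xs} {ys} x y q) = begin
  p x ∧ p y ∧ allᵇ p xs  ≡⟨ cong (λ r → p x ∧ p y ∧ r) (all-↭ p q) ⟩
  p x ∧ p y ∧ allᵇ p ys  ≡⟨ ∧-laws.x∙yz≈y∙xz (p x) (p y) _ ⟩
  p y ∧ p x ∧ allᵇ p ys  ∎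
  where open ≡-Reasoning

isMatching-↭ : PermInvariant (isMatchingᵇ {n})
isMatching-↭ refl        = refl
isMatching-↭ (trans p q) = ≡-trans (isMatching-↭ p) (isMatching-↭ q)
isMatching-↭ (prep e p)  = cong₂ _∧_ (all-↭ (disjointᵇ e) p) (isMatching-↭ p)
isMatching-↭ (swap {M} {M′} e f p) = begin
  (disjointᵇ e f ∧ allᵇ (disjointᵇ e) M) ∧ (allᵇ (disjointᵇ f) M ∧ isMatchingᵇ M)
    ≡⟨ cong₂ (λ r s → (disjointᵇ e f ∧ r) ∧ s) (all-↭ (disjointᵇ e) p)
             (cong₂ _∧_ (all-↭ (disjointᵇ f) p) (isMatching-↭ p)) ⟩
  (disjointᵇ e f ∧ allᵇ (disjointᵇ e) M′) ∧ (allᵇ (disjointᵇ f) M′ ∧ isMatchingᵇ M′)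
    ≡⟨ ∧-laws.interchange (disjointᵇ e f) _ _ _ ⟩
  (disjointᵇ e f ∧ allᵇ (disjointᵇ f) M′) ∧ (allᵇ (disjointᵇ e) M′ ∧ isMatchingᵇ M′)
    ≡⟨ cong (λ r → (r ∧ allᵇ (disjointᵇ f) M′) ∧ _) (disjoint-sym e f) ⟩
  (disjointᵇ f e ∧ allᵇ (disjointᵇ f) M′) ∧ (allᵇ (disjointᵇ e) M′ ∧ isMatchingᵇ M′)
    ∎
  where open ≡-Reasoning

isMatching-map : ∀ (g : Edge n → Edge n) → (∀ e f → disjointᵇ (g e) (g f) ≡ disjointᵇ e f) →
  ∀ M → isMatchingᵇ (map g M) ≡ isMatchingᵇ M
isMatching-map g g-disj []      = refl
isMatching-map g g-disj (e ∷ M) = cong₂ _∧_ (all-map M) (isMatching-map g g-disj M)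
  where
  all-map : ∀ M → allᵇ (disjointᵇ (g e)) (map g M) ≡ allᵇ (disjointᵇ e) M
  all-map []      = refl
  all-map (f ∷ M) = cong₂ _∧_ (g-disj e f) (all-map M)

isEdgeᵇ : Graph n → Edge n → Bool
isEdgeᵇ G (a , b) = (toℕ a <ᵇ toℕ b) ∧ adj G a b

allPairs : ∀ n → List (Edge n)
allPairs n = cartesianProduct (allFin n) (allFin n)

edges≡filter : ∀ (G : Graph n) → edges G ≡ filter (λ e → T? (isEdgeᵇ G e)) (allPairs n)
edges≡filter {n} G = rows (allFin n)
  where
  row : ∀ i ys →
    concatMap (λ j → if (toℕ i <ᵇ toℕ j) ∧ adj G i j then (i , j) ∷ [] else []) ys
    ≡ filter (λ e → T? (isEdgeᵇ G e)) (map (i ,_) ys)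
  row i []       = refl
  row i (j ∷ ys) with (toℕ i <ᵇ toℕ j) ∧ adj G i j
  ... | true  = cong ((i , j) ∷_) (row i ys)
  ... | false = row i ys
  rows : ∀ xs →
    concatMap (λ i → concatMap (λ j → if (toℕ i <ᵇ toℕ j) ∧ adj G i j then (i , j) ∷ [] else []) (allFin n)) xs
    ≡ filter (λ e → T? (isEdgeᵇ G e)) (cartesianProduct xs (allFin n))
  rows []       = refl
  rows (i ∷ xs) = ≡-trans (cong₂ _++_ (row i (allFin n)) (rows xs))
                    (sym (filter-++ (λ e → T? (isEdgeᵇ G e)) (map (i ,_) (allFin n)) _))

unique-edges : ∀ (G : Graph n) → Unique (edges G)
unique-edges {n} G rewrite edges≡filter G =
  Unique.filter⁺ _ (Unique.cartesianProduct⁺ (Unique.allFin⁺ n) (Unique.allFin⁺ n))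

∈-edges⁺ : ∀ (G : Graph n) {a b} → toℕ a < toℕ b → adj G a b ≡ true → (a , b) ∈ edges G
∈-edges⁺ G {a} {b} a<b ab rewrite edges≡filter G =
  ∈-filter⁺ _ (∈-cartesianProduct⁺ (∈-allFin a) (∈-allFin b)) (from T-∧ (<⇒<ᵇ a<b , from T-≡ ab))

∈-edges⁻ : ∀ (G : Graph n) {a b} → (a , b) ∈ edges G → toℕ a < toℕ b × adj G a b ≡ true
∈-edges⁻ {n} G {a} {b} ab∈ rewrite edges≡filter G
  with (a<ᵇb , ab) ← to T-∧ (proj₂ (∈-filter⁻ (λ e → T? (isEdgeᵇ G e)) {xs = allPairs n} ab∈)) =
  <ᵇ⇒< _ _ a<ᵇb , to T-≡ ab

adj-≢ : ∀ (G : Graph n) {a b} → adj G a b ≡ true → a ≢ b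
adj-≢ G {a} ab refl with ≡-trans (sym ab) (irrefl G a)
... | ()

orient-adj : ∀ (G : Graph n) {a b} → adj G a b ≡ true →
  adj G (proj₁ (orient (a , b))) (proj₂ (orient (a , b))) ≡ true
orient-adj G {a} {b} ab with orient-cases a b
... | inj₁ eq rewrite eq = ab
... | inj₂ eq rewrite eq = ≡-trans (Graph.sym G b a) ab

orient-∈-edges : ∀ (G : Graph n) {a b} → adj G a b ≡ true → orient (a , b) ∈ edges G
orient-∈-edges G ab = ∈-edges⁺ G (orient-ordered (adj-≢ G ab)) (orient-adj G ab)

orient-∈-edges⁻ : ∀ (G : Graph n) {a b} → orient (a , b) ∈ edges G → adj G a b ≡ true
orient-∈-edges⁻ G {a} {b} o∈ with orient (a , b) | orient-cases a b
... | _ | inj₁ refl = proj₂ (∈-edges⁻ G o∈)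
... | _ | inj₂ refl = ≡-trans (Graph.sym G a b) (proj₂ (∈-edges⁻ G o∈))

_⊑_ : Graph n → Graph n → Set
G ⊑ H = ∀ i j → adj G i j ≡ true → adj H i j ≡ true

edges-⊆ : ∀ {G H : Graph n} → G ⊑ H → edges G ⊆ edges H
edges-⊆ {n} {G} {H} G⊑H rewrite edges≡filter G | edges≡filter H =
  filter⁺ (λ e → T? (isEdgeᵇ G e)) (λ e → T? (isEdgeᵇ H e)) isEdge-mono (⊆-refl {x = allPairs n})
  where
  isEdge-mono : ∀ {e f} → e ≡ f → T (isEdgeᵇ G e) → T (isEdgeᵇ H f)
  isEdge-mono {a , b} refl e∈G with (a<ᵇb , ab) ← to T-∧ e∈G =
    from T-∧ (a<ᵇb , from T-≡ (G⊑H a b (to T-≡ ab)))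

matchings-1 : ∀ (G : Graph n) → matchings G 1 ≡ length (edges G)
matchings-1 G = #-choose-1 isMatchingᵇ (λ _ → refl) (edges G)

-- If an injective vertex map f sends edges of G to edges of H, then m(G,t) ≤ m(H,t) for
-- all t: the f-images of the edges of G form (up to order) a sublist of the edges of H,
-- and matchings correspond to matchings.
matchings-embedding : ∀ {G H : Graph n} (f : Fin n → Fin n) → Injective _≡_ _≡_ f →
  (∀ i j → adj G i j ≡ true → adj H (f i) (f j) ≡ true) → ∀ t → matchings G t ≤ matchings H t
matchings-embedding {n} {G} {H} f f-inj f-adj t =
  compare (unique-⊆⇒↭-sublist (≡-dec _≟_ _≟_) (unique-map φ φ-injective (unique-edges G)) (unique-edges H) φ-into)
  where
  φ : Edge n → Edge n
  φ (a , b) = orient (f a , f b)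
  φ-disjoint : ∀ e e′ → disjointᵇ (φ e) (φ e′) ≡ disjointᵇ e e′
  φ-disjoint (a , b) (c , d) =
    ≡-trans (disjoint-orient (f a , f b) (f c , f d)) (disjoint-injective f-inj a b c d)
  φ-injective : ∀ {e e′} → e ∈ edges G → e′ ∈ edges G → φ e ≡ φ e′ → e ≡ e′
  φ-injective {a , b} {c , d} e∈ e′∈ eq with orient-≡ eq
  ... | inj₁ (fa≡fc , fb≡fd) = cong₂ _,_ (f-inj fa≡fc) (f-inj fb≡fd)
  ... | inj₂ (fa≡fd , fb≡fc) with f-inj fa≡fd | f-inj fb≡fc
  ...   | refl | refl = contradiction (proj₁ (∈-edges⁻ G e′∈)) (<-asym (proj₁ (∈-edges⁻ G e∈)))
  φ-into : ∀ {e} → e ∈ map φ (edges G) → e ∈ edges H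
  φ-into e∈ with ((a , b) , ab∈ , refl) ← ∈-map⁻ φ e∈ =
    orient-∈-edges H (f-adj a b (proj₂ (∈-edges⁻ G ab∈)))
  compare : ∃[ zs ] (map φ (edges G) ↭ zs × zs ⊆ edges H) → matchings G t ≤ matchings H t
  compare (zs , φ[E]↭zs , zs⊆E) = begin
    #[ isMatchingᵇ ] (choose t (edges G))
      ≡⟨ #-cong (λ M → sym (isMatching-map φ φ-disjoint M)) (choose t (edges G)) ⟩
    #[ (λ M → isMatchingᵇ (map φ M)) ] (choose t (edges G))
      ≡⟨ sym (#-choose-map isMatchingᵇ φ t (edges G)) ⟩
    #[ isMatchingᵇ ] (choose t (map φ (edges G)))
      ≡⟨ sameCounts-↭ φ[E]↭zs isMatchingᵇ isMatching-↭ t ⟩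
    #[ isMatchingᵇ ] (choose t zs)
      ≤⟨ #-choose-⊆ isMatchingᵇ t zs⊆E ⟩
    #[ isMatchingᵇ ] (choose t (edges H))
      ∎
    where open ≤-Reasoning

⟨$⟩ʳ-injective : ∀ (π : Permutation′ n) → Injective _≡_ _≡_ (π ⟨$⟩ʳ_)
⟨$⟩ʳ-injective π {i} {j} eq = ≡-trans (sym (inverseˡ π {i})) (≡-trans (cong (π ⟨$⟩ˡ_) eq) (inverseˡ π {j}))

⟨$⟩ˡ-injective : ∀ (π : Permutation′ n) → Injective _≡_ _≡_ (π ⟨$⟩ˡ_)
⟨$⟩ˡ-injective π {i} {j} eq = ≡-trans (sym (inverseʳ π {i})) (≡-trans (cong (π ⟨$⟩ʳ_) eq) (inverseʳ π {j}))

-- Isomorphic graphs have the same matching numbers (embed in both directions).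
iso-matchings : ∀ {G H : Graph n} → Iso G H → ∀ t → matchings G t ≡ matchings H t
iso-matchings {G = G} {H} (π , π-adj) t = ≤-antisym
  (matchings-embedding {G = G} {H} (π ⟨$⟩ʳ_) (⟨$⟩ʳ-injective π) (λ i j ij → ≡-trans (sym (π-adj i j)) ij) t)
  (matchings-embedding {G = H} {G} (π ⟨$⟩ˡ_) (⟨$⟩ˡ-injective π) backwards t)
  where
  backwards : ∀ i j → adj H i j ≡ true → adj G (π ⟨$⟩ˡ i) (π ⟨$⟩ˡ j) ≡ true
  backwards i j ij = ≡-trans (π-adj _ _) (≡-trans (cong₂ (adj H) (inverseʳ π) (inverseʳ π)) ij)

≺-resp-iso : ∀ {G G′ H : Graph n} → Iso G G′ → G′ ≺ H → G ≺ H
≺-resp-iso {G = G} {G′} G≅G′ (G′⪯H , t , t≤ , G′<H) =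
  (λ s s≤ → subst (_≤ _) (sym (iso-matchings {G = G} {G′} G≅G′ s)) (G′⪯H s s≤)) ,
  t , t≤ , subst (_< _) (sym (iso-matchings {G = G} {G′} G≅G′ t)) G′<H

-- A spanning subgraph missing an edge of H is ≺ H: it has no more t-matchings for any t
-- and strictly fewer edges.
subgraph≺ : ∀ {G H : Graph n} → G ⊑ H → ∀ {i j} → adj H i j ≡ true → adj G i j ≡ false →
  1 ≤ ⌊ n /2⌋ → G ≺ H
subgraph≺ {G = G} {H} G⊑H Hij Gij 1≤n/2 =
  (λ t _ → #-choose-⊆ isMatchingᵇ t (edges-⊆ {G = G} {H} G⊑H)) ,
  1 , 1≤n/2 ,
  subst₂ _<_ (sym (matchings-1 G)) (sym (matchings-1 H))
    (sublist-length-< (edges-⊆ {G = G} {H} G⊑H) (orient-∈-edges H Hij)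
      (λ o∈G → contradiction (≡-trans (sym Gij) (orient-∈-edges⁻ G o∈G)) λ ()))

subgraph-cases : ∀ {G H : Graph n} → G ⊑ H →
  (∀ i j → adj G i j ≡ adj H i j) ⊎ ∃₂ (λ i j → adj H i j ≡ true × adj G i j ≡ false)
subgraph-cases {n} {G} {H} G⊑H with all? (λ i → all? (λ j → adj G i j Bool.≟ adj H i j))
... | yes same = inj₁ same
... | no ¬same
  with (i , ¬same-i) ← ¬∀⟶∃¬ n _ (λ i → all? (λ j → adj G i j Bool.≟ adj H i j)) ¬same
  with (j , Gij≢Hij) ← ¬∀⟶∃¬ n _ (λ j → adj G i j Bool.≟ adj H i j) ¬same-i
  with adj G i j in Gij | adj H i j in Hij
... | true  | true  = contradiction refl Gij≢Hij
... | false | false = contradiction refl Gij≢Hij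
... | false | true  = inj₂ (i , j , Hij , Gij)
... | true  | false with () ← ≡-trans (sym (G⊑H i j Gij)) Hij

-- The copy of G whose vertex i is renamed π i.
relabel : Permutation′ n → Graph n → Graph n
relabel π G = record
  { adj    = λ x y → adj G (π ⟨$⟩ˡ x) (π ⟨$⟩ˡ y)
  ; sym    = λ x y → Graph.sym G (π ⟨$⟩ˡ x) (π ⟨$⟩ˡ y)
  ; irrefl = λ x → irrefl G (π ⟨$⟩ˡ x)
  }

relabel-iso : ∀ (π : Permutation′ n) (G : Graph n) → Iso G (relabel π G)
relabel-iso π G = π , λ i j → sym (cong₂ (adj G) (inverseˡ π) (inverseˡ π))

-- If a permutation π maps every edge of G to an edge of H and G ≇ H, then G ≺ H:
-- the relabelled copy of G is a spanning subgraph of H, different from H.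
embedding≺ : ∀ {G H : Graph n} (π : Permutation′ n) →
  (∀ i j → adj G i j ≡ true → adj H (π ⟨$⟩ʳ i) (π ⟨$⟩ʳ j) ≡ true) →
  ¬ Iso G H → 1 ≤ ⌊ n /2⌋ → G ≺ H
embedding≺ {n} {G} {H} π π-adj G≇H 1≤n/2 = conclude (subgraph-cases {G = G′} {H} G′⊑H)
  where
  G′ : Graph n
  G′ = relabel π G
  G′⊑H : G′ ⊑ H
  G′⊑H x y xy = subst₂ (λ u w → adj H u w ≡ true) (inverseʳ π) (inverseʳ π) (π-adj _ _ xy)
  conclude : (∀ i j → adj G′ i j ≡ adj H i j) ⊎ ∃₂ (λ i j → adj H i j ≡ true × adj G′ i j ≡ false) → G ≺ H
  conclude (inj₁ same) = contradiction (π , λ i j → ≡-trans (proj₂ (relabel-iso π G) i j) (same _ _)) G≇H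
  conclude (inj₂ (i , j , Hij , G′ij)) =
    ≺-resp-iso {G = G} {G′} {H} (relabel-iso π G) (subgraph≺ {G = G′} {H} G′⊑H Hij G′ij 1≤n/2)

count : (Fin n → Bool) → ℕ
count {n} P = #[ P ] (allFin n)

count-tail : ∀ (P : Fin (suc n) → Bool) → #[ P ] (tabulate suc) ≡ count (λ i → P (suc i))
count-tail {n} P = ≡-trans (cong #[ P ] (sym (map-tabulate id suc))) (#-map P suc (allFin n))

count-suc-true : ∀ (P : Fin (suc n) → Bool) → P zero ≡ true → count P ≡ suc (count (λ i → P (suc i)))
count-suc-true P P0 = ≡-trans (#-∷-true P (tabulate suc) P0) (cong suc (count-tail P))

count-suc-false : ∀ (P : Fin (suc n) → Bool) → P zero ≡ false → count P ≡ count (λ i → P (suc i))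
count-suc-false P P0 = ≡-trans (#-∷-false P (tabulate suc) P0) (count-tail P)

insert-centre : ∀ (i j : Fin (suc m)) (ρ : Permutation′ m) → insert i j ρ ⟨$⟩ʳ i ≡ j
insert-centre i j ρ with i ≟ i
... | yes _   = refl
... | no  i≢i = contradiction refl i≢i

toℕ-punchIn-fromℕ : ∀ (j : Fin n) → toℕ (punchIn (fromℕ n) j) ≡ toℕ j
toℕ-punchIn-fromℕ zero    = refl
toℕ-punchIn-fromℕ (suc j) = cong suc (toℕ-punchIn-fromℕ j)

-- Any set P of positions can be moved to the front: some permutation sends P into
-- {0, …, |P| - 1}.  By induction, inserting position 0 at the front or at the back.
partition : ∀ (P : Fin n → Bool) →
  Σ[ ρ ∈ Permutation′ n ] (∀ i → P i ≡ true → toℕ (ρ ⟨$⟩ʳ i) < count P)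
partition {zero}  P = Permutation.id , λ ()
partition {suc n} P = extend (P zero) refl (partition (λ i → P (suc i)))
  where
  Front : Permutation′ (suc n) → Set
  Front ρ = ∀ i → P i ≡ true → toℕ (ρ ⟨$⟩ʳ i) < count P
  extend : ∀ b → P zero ≡ b →
    Σ[ ρ ∈ Permutation′ n ] (∀ i → P (suc i) ≡ true → toℕ (ρ ⟨$⟩ʳ i) < count (λ i → P (suc i))) →
    Σ[ ρ ∈ Permutation′ (suc n) ] Front ρ
  extend true P0 (ρ , ρ-front) = insert zero zero ρ , front
    where
    front : Front (insert zero zero ρ)
    front zero    _  rewrite insert-centre zero zero ρ | count-suc-true P P0 = s≤s z≤n
    front (suc i) Pi rewrite insert-punchIn zero zero ρ i | count-suc-true P P0 = s≤s (ρ-front i Pi)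
  extend false P0 (ρ , ρ-front) = insert zero (fromℕ n) ρ , front
    where
    front : Front (insert zero (fromℕ n) ρ)
    front zero    P0′ = contradiction (≡-trans (sym P0′) P0) λ ()
    front (suc i) Pi rewrite insert-punchIn zero (fromℕ n) ρ i | toℕ-punchIn-fromℕ (ρ ⟨$⟩ʳ i)
                           | count-suc-false P P0 = ρ-front i Pi

star-permutation : ∀ (v : Fin (suc m)) (N : Fin (suc m) → Bool) →
  Σ[ π ∈ Permutation′ (suc m) ] (π ⟨$⟩ʳ v ≡ zero ×
    ∀ u → u ≢ v → ∃[ b ] (π ⟨$⟩ʳ u ≡ suc b × (N u ≡ true → toℕ b < count (λ k → N (punchIn v k)))))
star-permutation {m} v N with (ρ , ρ-front) ← partition (λ k → N (punchIn v k)) =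
  insert v zero ρ , insert-centre v zero ρ , leaf
  where
  leaf : ∀ u → u ≢ v →
    ∃[ b ] (insert v zero ρ ⟨$⟩ʳ u ≡ suc b × (N u ≡ true → toℕ b < count (λ k → N (punchIn v k))))
  leaf u u≢v =
    ρ ⟨$⟩ʳ k ,
    subst (λ w → insert v zero ρ ⟨$⟩ʳ w ≡ suc (ρ ⟨$⟩ʳ k)) v̂k≡u (insert-punchIn v zero ρ k) ,
    λ Nu → ρ-front k (subst (λ w → N w ≡ true) (sym v̂k≡u) Nu)
    where
    k : Fin m
    k = punchOut (u≢v ∘ sym)
    v̂k≡u : punchIn v k ≡ u
    v̂k≡u = punchIn-punchOut (u≢v ∘ sym)

degree : Graph (suc m) → Fin (suc m) → ℕ
degree G v = count (λ k → adj G v (punchIn v k))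

single-self : ∀ (v : Fin (suc m)) → single v v ≡ true
single-self v with v ≟ v
... | yes _   = refl
... | no  v≢v = contradiction refl v≢v

single-other : ∀ {u v : Fin (suc m)} → u ≢ v → single v u ≡ false
single-other {u = u} {v} u≢v with u ≟ v
... | yes u≡v = contradiction u≡v u≢v
... | no  _   = refl

-- deg(v) ≤ |∂({v})|: the spokes {v, u} to the neighbours u are distinct edges crossing the cut.
degree≤cut : ∀ (G : Graph (suc m)) v → degree G v ≤ cutSize G (single v)
degree≤cut {m} G v =
  subst (_≤ cutSize G (single v)) (length-map spoke leaves)
    (unique-length-≤ (≡-dec _≟_ _≟_)
      (Unique.map⁺ spoke-injective (Unique.filter⁺ _ (Unique.allFin⁺ m)))
      (Unique.filter⁺ _ (unique-edges G))
      spoke∈cut)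
  where
  leaves : List (Fin m)
  leaves = filter (λ k → T? (adj G v (punchIn v k))) (allFin m)
  spoke : Fin m → Edge (suc m)
  spoke k = orient (v , punchIn v k)
  spoke-injective : ∀ {k l} → spoke k ≡ spoke l → k ≡ l
  spoke-injective {k} {l} eq with orient-≡ eq
  ... | inj₁ (_ , v̂k≡v̂l) = punchIn-injective v k l v̂k≡v̂l
  ... | inj₂ (v≡v̂l , _)  = contradiction (sym v≡v̂l) (punchInᵢ≢i v l)
  crosses : ∀ k → single v (proj₁ (spoke k)) xor single v (proj₂ (spoke k)) ≡ true
  crosses k with orient-cases v (punchIn v k)
  ... | inj₁ eq rewrite eq | single-self v | single-other (punchInᵢ≢i v k) = refl
  ... | inj₂ eq rewrite eq | single-self v | single-other (punchInᵢ≢i v k) = refl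
  spoke∈cut : ∀ {e} → e ∈ map spoke leaves → e ∈ cut G (single v)
  spoke∈cut e∈ with (k , k∈ , refl) ← ∈-map⁻ spoke e∈ =
    ∈-filter⁺ _ (orient-∈-edges G (to T-≡ (proj₂ (∈-filter⁻ (λ k → T? (adj G v (punchIn v k))) {xs = allFin m} k∈))))
      (from T-≡ (crosses k))

K-centre : ∀ k {b : Fin m} → toℕ b < k → adj (K (suc m) k) zero (suc b) ≡ true
K-centre k b<k = to T-≡ (<⇒<ᵇ b<k)

K-clique : ∀ k {a b : Fin m} → a ≢ b → adj (K (suc m) k) (suc a) (suc b) ≡ true
K-clique k {a} {b} a≢b with a ≟ b
... | yes a≡b = contradiction a≡b a≢b
... | no  _   = refl

star-embedding : ∀ (G : Graph (suc m)) v k → degree G v ≤ k →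
  Σ[ π ∈ Permutation′ (suc m) ] (∀ i j → adj G i j ≡ true → adj (K (suc m) k) (π ⟨$⟩ʳ i) (π ⟨$⟩ʳ j) ≡ true)
star-embedding {m} G v k deg≤k with (π , π-centre , π-leaf) ← star-permutation v (adj G v) = π , embeds
  where
  Kₖ : Graph (suc m)
  Kₖ = K (suc m) k
  embeds : ∀ i j → adj G i j ≡ true → adj Kₖ (π ⟨$⟩ʳ i) (π ⟨$⟩ʳ j) ≡ true
  embeds i j ij with i ≟ v | j ≟ v
  ... | yes refl | yes refl = contradiction refl (adj-≢ G ij)
  ... | yes refl | no j≢v with (b , πj , b<deg) ← π-leaf j j≢v
    rewrite π-centre | πj = K-centre k (≤-trans (b<deg ij) deg≤k)
  ... | no i≢v | yes refl with (a , πi , a<deg) ← π-leaf i i≢v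
    rewrite π-centre | πi =
      ≡-trans (Graph.sym Kₖ (suc a) zero) (K-centre k (≤-trans (a<deg (≡-trans (Graph.sym G v i) ij)) deg≤k))
  ... | no i≢v | no j≢v with (a , πi , _) ← π-leaf i i≢v | (b , πj , _) ← π-leaf j j≢v
    rewrite πi | πj =
      K-clique k (λ a≡b → adj-≢ G ij (⟨$⟩ʳ-injective π (≡-trans πi (≡-trans (cong suc a≡b) (sym πj)))))

-- The theorem: a vertex v with |∂({v})| = k has degree ≤ k, so G embeds into K^k_{n-1,1}
-- by the star permutation, and G ≇ K^k_{n-1,1} makes the comparison strict.
lemma2p1 : (n k : ℕ) → 2 ≤ n → 1 ≤ k → k ≤ n ∸ 1 →
    (G : Graph n) → Connected G → EdgeConnectivity G k → HasTrivialCut G k →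
    ¬ Iso G (K n k) → G ≺ K n k
lemma2p1 (suc m) k 2≤n _ _ G _ _ (v , ∂v≡k) G≇K
  with (π , π-embeds) ← star-embedding G v k (subst (degree G v ≤_) ∂v≡k (degree≤cut G v)) =
  embedding≺ {G = G} {K (suc m) k} π π-embeds G≇K (⌊n/2⌋-mono 2≤n)
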